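{- Let $\alpha=3+2\sqrt{2}$, $\beta=3-2\sqrt{2}$, and for integers $n\ge 0$ let $T_n=\frac{\alpha^n-\beta^n}{4\sqrt{2}}$ and $L_n=\alpha^n+\beta^n$. Let $r,s$ be integers and let $(A_n)_{n\ge 0}$ be defined by $A_0=r$, $A_1=s$, $A_n=6A_{n-1}-A_{n-2}$ for $n\ge 2$. Then for every integer $n\ge 1$, $$32A_n^2+2(r^2+s^2-6rs)=(r^2-s^2)L_{2n-2}+(6s^2-2rs)L_{2n-1}.$$
   Context: $L_n$ satisfies $L_0=2$, $L_1=6$, $L_n=6L_{n-1}-L_{n-2}$. -}

module Defs where

open import Data.Nat using (ℕ; zero; suc)
open import Data.Integer using (ℤ; +_; _+_; _-_; _*_)

A : ℤ → ℤ → ℕ → ℤ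
A r s zero = r
A r s (suc zero) = s
A r s (suc (suc n)) = + 6 * A r s (suc n) - A r s n

-- L n = α^n + β^n with α,β = 3 ± 2√2, i.e. L 0 = 2, L 1 = 6, L (n+2) = 6 L (n+1) - L n.
L : ℕ → ℤ
L n = A (+ 2) (+ 6) n

-- With T the solution starting 0, 1, every solution is A r s (m + 1) = s T (m + 1) − r T m,
-- and the quadratic form x² − 6xy + y² is invariant along any solution, so it equals 1 on
-- consecutive values of T. The doubling formulas L (2m) = 32 T m² + 2 and
-- L (2m + 1) = 32 T m T (m + 1) + 6 then turn the theorem into a polynomial identity
-- in r, s, T m, T (m + 1) that holds modulo T m² − 6 T m T (m + 1) + T (m + 1)² = 1.
module Submission where

open import Defs
open import Data.Nat using (ℕ; _≥_; _∸_; zero; suc) renaming (_*_ to _*ℕ_; _+_ to _+ℕ_)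
open import Data.Nat.Properties using (+-suc; +-identityʳ)
open import Data.Integer using (ℤ; +_; -_; _+_; _-_; _*_)
open import Data.Integer.Tactic.RingSolver using (solve-∀)
open import Relation.Binary.PropositionalEquality using (_≡_; refl; cong; cong₂; trans)
open Relation.Binary.PropositionalEquality.≡-Reasoning

-- The paper's (αⁿ − βⁿ) / (4√2).
T : ℕ → ℤ
T = A (+ 0) (+ 1)

form : ℤ → ℤ → ℤ
form x y = x * x - + 6 * x * y + y * y

form-step : ∀ x y → form y (+ 6 * y - x) ≡ form x y
form-step = expanded
  where
  -- solve-∀ does not unfold form, so here and below the identity is restated with it expanded.
  expanded : ∀ x y → y * y - + 6 * y * (+ 6 * y - x) + (+ 6 * y - x) * (+ 6 * y - x)
                   ≡ x * x - + 6 * x * y + y * y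
  expanded = solve-∀

form-A : ∀ r s m → form (A r s m) (A r s (suc m)) ≡ form r s
form-A r s zero    = refl
form-A r s (suc m) = trans (form-step (A r s m) (A r s (suc m))) (form-A r s m)

form-T : ∀ m → form (T m) (T (suc m)) ≡ + 1
form-T = form-A (+ 0) (+ 1)

A-suc≡s*T-r*T : ∀ r s m → A r s (suc m) ≡ s * T (suc m) - r * T m
A-suc≡s*T-r*T r s zero          = case-1 r s
  where
  case-1 : ∀ r s → s ≡ s * + 1 - r * + 0
  case-1 = solve-∀
A-suc≡s*T-r*T r s (suc zero)    = case-2 r s
  where
  case-2 : ∀ r s → + 6 * s - r ≡ s * + 6 - r * + 1
  case-2 = solve-∀
A-suc≡s*T-r*T r s (suc (suc m)) =
  trans (cong₂ (λ u v → + 6 * u - v) (A-suc≡s*T-r*T r s (suc m)) (A-suc≡s*T-r*T r s m))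
        (recurrence-linear r s (T (suc (suc m))) (T (suc m)) (T m))
  where
  recurrence-linear : ∀ r s a b c →
    + 6 * (s * a - r * b) - (s * b - r * c) ≡ s * (+ 6 * a - b) - r * (+ 6 * b - c)
  recurrence-linear = solve-∀

cancel-form : ∀ x y → form x y ≡ + 1 → ∀ a c → a + c * (form x y - + 1) ≡ a
cancel-form x y form≡1 a c = begin
  a + c * (form x y - + 1) ≡⟨ cong (λ t → a + c * (t - + 1)) form≡1 ⟩
  a + c * (+ 1 - + 1)      ≡⟨ zero-term a c ⟩
  a                        ∎
  where
  zero-term : ∀ a c → a + c * (+ 1 - + 1) ≡ a
  zero-term = solve-∀

mutual
  L-even : ∀ m → L (m +ℕ m) ≡ + 32 * (T m * T m) + + 2
  L-even zero    = refl
  L-even (suc m) rewrite +-suc m m = L-even-suc m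

  L-even-suc : ∀ m → L (suc (suc (m +ℕ m))) ≡ + 32 * (T (suc m) * T (suc m)) + + 2
  L-even-suc m = begin
    + 6 * L (suc (m +ℕ m)) - L (m +ℕ m)
      ≡⟨ cong₂ (λ u v → + 6 * u - v) (L-odd m) (L-even m) ⟩
    + 6 * (+ 32 * (x * y) + + 6) - (+ 32 * (x * x) + + 2)
      ≡⟨ step x y ⟩
    + 32 * (y * y) + + 2 + - + 32 * (form x y - + 1)
      ≡⟨ cancel-form x y (form-T m) (+ 32 * (y * y) + + 2) (- + 32) ⟩
    + 32 * (y * y) + + 2 ∎
    where
    x = T m
    y = T (suc m)
    step : ∀ x y → + 6 * (+ 32 * (x * y) + + 6) - (+ 32 * (x * x) + + 2)
                 ≡ + 32 * (y * y) + + 2 + - + 32 * (form x y - + 1)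
    step = expanded
      where
      expanded : ∀ x y → + 6 * (+ 32 * (x * y) + + 6) - (+ 32 * (x * x) + + 2)
                       ≡ + 32 * (y * y) + + 2 + - + 32 * ((x * x - + 6 * x * y + y * y) - + 1)
      expanded = solve-∀

  L-odd : ∀ m → L (suc (m +ℕ m)) ≡ + 32 * (T m * T (suc m)) + + 6
  L-odd zero    = refl
  L-odd (suc m) rewrite +-suc m m =
    trans (cong₂ (λ u v → + 6 * u - v) (L-even-suc m) (L-odd m)) (step (T m) (T (suc m)))
    where
    step : ∀ x y → + 6 * (+ 32 * (y * y) + + 2) - (+ 32 * (x * y) + + 6)
                 ≡ + 32 * (y * (+ 6 * y - x)) + + 6
    step = solve-∀

identity-mod-form : ∀ r s x y → form x y ≡ + 1 →
  + 32 * ((s * y - r * x) * (s * y - r * x)) + + 2 * (r * r + s * s - + 6 * r * s)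
    ≡ (r * r - s * s) * (+ 32 * (x * x) + + 2)
      + (+ 6 * (s * s) - + 2 * r * s) * (+ 32 * (x * y) + + 6)
identity-mod-form r s x y form≡1 =
  trans (expanded r s x y) (cancel-form x y form≡1 _ (+ 32 * (s * s)))
  where
  expanded : ∀ r s x y →
    + 32 * ((s * y - r * x) * (s * y - r * x)) + + 2 * (r * r + s * s - + 6 * r * s)
      ≡ (r * r - s * s) * (+ 32 * (x * x) + + 2)
        + (+ 6 * (s * s) - + 2 * r * s) * (+ 32 * (x * y) + + 6)
        + + 32 * (s * s) * ((x * x - + 6 * x * y + y * y) - + 1)
  expanded = solve-∀

2*[1+m]∸2≡m+m : ∀ m → 2 *ℕ suc m ∸ 2 ≡ m +ℕ m
2*[1+m]∸2≡m+m m rewrite +-identityʳ m = cong (_∸ 1) (+-suc m m)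

2*[1+m]∸1≡1+m+m : ∀ m → 2 *ℕ suc m ∸ 1 ≡ suc (m +ℕ m)
2*[1+m]∸1≡1+m+m m rewrite +-identityʳ m = +-suc m m

mainTheorem1 : (r s : ℤ) (n : ℕ) → n ≥ 1 →
    + 32 * (A r s n * A r s n) + + 2 * (r * r + s * s - + 6 * r * s)
      ≡ (r * r - s * s) * L (2 *ℕ n ∸ 2)
        + (+ 6 * (s * s) - + 2 * r * s) * L (2 *ℕ n ∸ 1)
mainTheorem1 r s (suc m) _
  rewrite 2*[1+m]∸2≡m+m m | 2*[1+m]∸1≡1+m+m m
        | A-suc≡s*T-r*T r s m | L-even m | L-odd m
  = identity-mod-form r s (T m) (T (suc m)) (form-T m)
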